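{- Let $G$ be the group of Construction A in the context with $q$ odd. Then the nilpotency class of $G$ is $2$ or $3$, and it is $3$ if and only if $\deg(S_1)>1$.
   Context: Let $q=p^m$ with $p$ prime. $E(a,b,c,t)$ is the $4\times4$ matrix with rows $(1,0,0,0),(-c,1,0,0),(b-ct,t,1,0),(a,b,c,1)$. Construction A: let $S_1(X)=\sum_{i=0}^{m-1}s_iX^{p^i}$ be a reduced linearized polynomial over $\mathbb{F}_q$, and $G=\{E(a,b,c,S_1(c)):a,b,c\in\mathbb{F}_q\}$, a group under matrix multiplication (here all Frobenius parts are trivial). $\deg(S_1)$ is the degree of the polynomial $S_1$. -}

module Defs where

open import Level using (Level; _⊔_; suc)
open import Data.Nat as ℕ using (ℕ; zero) renaming (suc to sucℕ)
open import Data.Fin using (Fin; toℕ) renaming (zero to f0; suc to fs)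
open import Data.Product using (Σ; ∃; ∃-syntax; _×_; _,_)
open import Relation.Nullary using (¬_)
open import Algebra.Bundles using (CommutativeRing)
open import Function.Bundles using (_⇔_)
open import Relation.Binary.PropositionalEquality using (_≡_)

record IsField {c ℓ : Level} (R : CommutativeRing c ℓ) : Set (c ⊔ ℓ) where
  open CommutativeRing R
  field
    0≉1     : ¬ (0# ≈ 1#)
    inverse : ∀ x → ¬ (x ≈ 0#) → ∃[ y ] (x * y ≈ 1#)

record HasSize {c ℓ : Level} (R : CommutativeRing c ℓ) (n : ℕ) : Set (c ⊔ ℓ) where
  open CommutativeRing R
  field
    enum      : Fin n → Carrier
    enum-inj  : ∀ i j → enum i ≈ enum j → i ≡ j
    enum-surj : ∀ x → ∃[ i ] (enum i ≈ x)

module _ {c ℓ : Level} (R : CommutativeRing c ℓ) where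
  open CommutativeRing R

  pow : Carrier → ℕ → Carrier
  pow x zero     = 1#
  pow x (sucℕ n) = x * pow x n

  sumF : (n : ℕ) → (Fin n → Carrier) → Carrier
  sumF zero     f = 0#
  sumF (sucℕ n) f = f f0 + sumF n (λ i → f (fs i))

  linEval : (p m : ℕ) → (Fin m → Carrier) → Carrier → Carrier
  linEval p m s x = sumF m (λ i → s i * pow x (p ℕ.^ toℕ i))

  -- deg(S) > 1 : some coefficient s_i with p^i > 1 is nonzero
  -- (for prime p, p^i > 1 iff i ≥ 1)
  DegGT1 : (p m : ℕ) → (Fin m → Carrier) → Set ℓ
  DegGT1 p m s = ∃[ i ] ((1 ℕ.< p ℕ.^ toℕ i) × ¬ (s i ≈ 0#))

  Mat : Set c
  Mat = Fin 4 → Fin 4 → Carrier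

  _≈M_ : Mat → Mat → Set ℓ
  A ≈M B = ∀ i j → A i j ≈ B i j

  _*M_ : Mat → Mat → Mat
  (A *M B) i j = sumF 4 (λ k → A i k * B k j)

  IdM : Mat
  IdM f0 f0 = 1#
  IdM (fs f0) (fs f0) = 1#
  IdM (fs (fs f0)) (fs (fs f0)) = 1#
  IdM (fs (fs (fs f0))) (fs (fs (fs f0))) = 1#
  IdM _ _ = 0#

  E : Carrier → Carrier → Carrier → Carrier → Mat
  E a b c t f0 f0 = 1#
  E a b c t f0 _  = 0#
  E a b c t (fs f0) f0 = - c
  E a b c t (fs f0) (fs f0) = 1#
  E a b c t (fs f0) _ = 0#
  E a b c t (fs (fs f0)) f0 = b - c * t
  E a b c t (fs (fs f0)) (fs f0) = t
  E a b c t (fs (fs f0)) (fs (fs f0)) = 1#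
  E a b c t (fs (fs f0)) _ = 0#
  E a b c t (fs (fs (fs f0))) f0 = a
  E a b c t (fs (fs (fs f0))) (fs f0) = b
  E a b c t (fs (fs (fs f0))) (fs (fs f0)) = c
  E a b c t (fs (fs (fs f0))) (fs (fs (fs f0))) = 1#

  GroupA : (p m : ℕ) → (Fin m → Carrier) → Mat → Set (c ⊔ ℓ)
  GroupA p m s M = ∃[ a ] ∃[ b ] ∃[ x ] (M ≈M E a b x (linEval p m s x))

  data Gen (S : Mat → Set (c ⊔ ℓ)) : Mat → Set (c ⊔ ℓ) where
    gen  : ∀ {x} → S x → Gen S x
    one  : Gen S IdM
    mul  : ∀ {x y} → Gen S x → Gen S y → Gen S (x *M y)
    inv  : ∀ {x y} → Gen S x → (x *M y) ≈M IdM → Gen S y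
    resp : ∀ {x y} → Gen S x → x ≈M y → Gen S y

  IsComm : Mat → Mat → Mat → Set (c ⊔ ℓ)
  IsComm x y z = ∃[ x' ] ∃[ y' ] ((x *M x') ≈M IdM × (y *M y') ≈M IdM
                   × z ≈M (((x' *M y') *M x) *M y))

  -- lower central series of a group H: γ 1 = H, γ (k+1) = [γ k, H]
  -- (index 0 is also set to H for convenience)
  LCS : (Mat → Set (c ⊔ ℓ)) → ℕ → Mat → Set (c ⊔ ℓ)
  LCS H zero = H
  LCS H (sucℕ zero) = H
  LCS H (sucℕ (sucℕ k)) =
    Gen (λ z → ∃[ x ] ∃[ y ] (LCS H (sucℕ k) x × H y × IsComm x y z))

  HasClass : (Mat → Set (c ⊔ ℓ)) → ℕ → Set (c ⊔ ℓ)
  HasClass H n = (∀ z → LCS H (sucℕ n) z → z ≈M IdM)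
               × ∃[ z ] (LCS H n z × ¬ (z ≈M IdM))

-- Write E(a,b,c,t) through its coordinates (a,b,c,t): matrix multiplication becomes a
-- polynomial group law on coordinates, and the commutator of E(a,b,c,t) and E(a',b',c',t')
-- is E(2(cb' - bc' + cc'(t - t')) - c²t' + c'²t, ct' - c't, 0, 0). So γ₂ lies in the subgroup
-- of the E(a,b,0,0), whose commutators with G are the central E(-2bc',0,0,0), and γ₄ = 1.
-- If deg S ≤ 1 then S(x) = s₀x, the b-coordinate ct' - c't vanishes and already γ₃ = 1.
-- Conversely 2 ≠ 0 as q is odd, which makes [E(0,1,0,S 0), E(0,0,1,S 1)] nontrivial; and if
-- deg S > 1 the polynomial X·S(1) - S(X) has degree < q and a nonzero coefficient, so
-- c·S(1) ≠ S(c) for some c and [[E(0,0,c,S c), h], h] with h = E(0,0,1,S 1) has a-coordinate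
-- -2(c·S(1) - S(c)) ≠ 0.
module Submission where

open import Level using (Level; _⊔_; 0ℓ)
open import Algebra.Bundles using (CommutativeRing; RawRing)
open import Algebra.Solver.Ring.AlmostCommutativeRing
  using (_-Raw-AlmostCommutative⟶_; fromCommutativeRing)
open import Data.Empty using (⊥-elim)
open import Data.Fin using (#_)
open import Data.Fin.Base as Fin using (Fin; toℕ) renaming (zero to f0; suc to fs)
import Data.Fin.Properties as Fin
open import Data.Integer.Base as ℤ using (ℤ; +_; -[1+_]; _⊖_)
import Data.Integer.Properties as ℤ
import Data.Maybe.Base as Maybe
open import Data.Nat.Base as ℕ using (ℕ; zero; suc; _^_)
open import Data.Nat.Divisibility using (_∣_; _∣0; ∣-refl; ∣m∣n⇒∣m+n)
open import Data.Nat.Primality using (Prime; prime⇒nonTrivial)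
import Data.Nat.Properties as ℕ
open import Data.Product.Base using (∃-syntax; _×_; _,_; proj₁; proj₂)
open import Data.Sign.Base as Sign using (Sign)
open import Data.Sum.Base using (_⊎_; inj₁; inj₂)
open import Data.Vec.Base using (Vec; []; _∷_; lookup; tabulate)
open import Data.Vec.Properties using (lookup∘tabulate)
open import Function.Base using (_∘_)
open import Function.Bundles using (_⇔_; mk⇔)
open import Relation.Binary.Bundles using (Setoid)
open import Relation.Binary.Definitions using (tri<; tri≈; tri>)
open import Relation.Binary.PropositionalEquality as ≡ using (_≡_; _≢_)
open import Relation.Nullary.Decidable as Dec using (Dec; yes; no; dec⇒maybe; _×-dec_)
open import Relation.Nullary.Negation using (¬_)

open import Defs

-- The library's solvers for an abstract commutative ring take the carrier itself as
-- coefficients, so a cancellation such as x - x ≈ 0 leaves an unevaluated coefficient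
-- 1# + - 1# behind. With coefficients in ℤ, mapped into R, normal forms compute.
module IntegerCoefficients {c ℓ} (R : CommutativeRing c ℓ) where
  open CommutativeRing R
  open import Algebra.Properties.Semiring.Mult.TCOptimised semiring
    using (1+×; ×-homo-+; ×1-homo-*) renaming (_×_ to _×ᴿ_)
  open import Algebra.Properties.Ring ring
    using (-‿involutive; -0#≈0#; -‿+-comm; -1*x≈-x)
  open import Algebra.Properties.CommutativeSemigroup *-commutativeSemigroup using (interchange)
  open import Algebra.Properties.CommutativeSemigroup +-commutativeSemigroup using (x∙yz≈y∙xz)
  open import Relation.Binary.Reasoning.Setoid setoid

  ℤ-rawRing : RawRing _ _
  ℤ-rawRing = record
    { Carrier = ℤ ; _≈_ = _≡_ ; _+_ = ℤ._+_ ; _*_ = ℤ._*_ ; -_ = ℤ.-_ ; 0# = + 0 ; 1# = + 1 }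

  ⟦_⟧ℤ : ℤ → Carrier
  ⟦ + n ⟧ℤ      = n ×ᴿ 1#
  ⟦ -[1+ n ] ⟧ℤ = - (suc n ×ᴿ 1#)

  [1+x]-[1+y]≈x-y : ∀ x y → (1# + x) - (1# + y) ≈ x - y
  [1+x]-[1+y]≈x-y x y = begin
    (1# + x) - (1# + y)     ≈⟨ +-congˡ (-‿+-comm 1# y) ⟨
    (1# + x) + (- 1# - y)   ≈⟨ +-assoc 1# x _ ⟩
    1# + (x + (- 1# - y))   ≈⟨ +-congˡ (x∙yz≈y∙xz x (- 1#) (- y)) ⟩
    1# + (- 1# + (x - y))   ≈⟨ +-assoc 1# (- 1#) _ ⟨
    (1# + - 1#) + (x - y)   ≈⟨ +-congʳ (-‿inverseʳ 1#) ⟩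
    0# + (x - y)            ≈⟨ +-identityˡ _ ⟩
    x - y                   ∎

  ⊖-homo : ∀ m n → ⟦ m ⊖ n ⟧ℤ ≈ m ×ᴿ 1# - n ×ᴿ 1#
  ⊖-homo zero    zero    = sym (-‿inverseʳ 0#)
  ⊖-homo zero    (suc n) = sym (+-identityˡ _)
  ⊖-homo (suc m) zero    = sym (trans (+-congˡ -0#≈0#) (+-identityʳ _))
  ⊖-homo (suc m) (suc n) = begin
    ⟦ suc m ⊖ suc n ⟧ℤ                ≡⟨ ≡.cong ⟦_⟧ℤ (ℤ.[1+m]⊖[1+n]≡m⊖n m n) ⟩
    ⟦ m ⊖ n ⟧ℤ                        ≈⟨ ⊖-homo m n ⟩
    m ×ᴿ 1# - n ×ᴿ 1#                 ≈⟨ [1+x]-[1+y]≈x-y _ _ ⟨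
    (1# + m ×ᴿ 1#) - (1# + n ×ᴿ 1#)   ≈⟨ +-cong (1+× m 1#) (-‿cong (1+× n 1#)) ⟨
    suc m ×ᴿ 1# - suc n ×ᴿ 1#         ∎

  +-homo : ∀ i j → ⟦ i ℤ.+ j ⟧ℤ ≈ ⟦ i ⟧ℤ + ⟦ j ⟧ℤ
  +-homo (+ m)      (+ n)      = ×-homo-+ 1# m n
  +-homo (+ m)      -[1+ n ]   = ⊖-homo m (suc n)
  +-homo -[1+ m ]   (+ n)      = trans (⊖-homo n (suc m)) (+-comm _ _)
  +-homo -[1+ m ]   -[1+ n ]   = begin
    - (suc (suc (m ℕ.+ n)) ×ᴿ 1#)   ≡⟨ ≡.cong (λ k → - (suc k ×ᴿ 1#)) (ℕ.+-suc m n) ⟨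
    - ((suc m ℕ.+ suc n) ×ᴿ 1#)     ≈⟨ -‿cong (×-homo-+ 1# (suc m) (suc n)) ⟩
    - (suc m ×ᴿ 1# + suc n ×ᴿ 1#)   ≈⟨ -‿+-comm _ _ ⟨
    ⟦ -[1+ m ] ⟧ℤ + ⟦ -[1+ n ] ⟧ℤ   ∎

  -‿homo : ∀ i → ⟦ ℤ.- i ⟧ℤ ≈ - ⟦ i ⟧ℤ
  -‿homo (+ zero)  = sym -0#≈0#
  -‿homo (+ suc n) = refl
  -‿homo -[1+ n ]  = sym (-‿involutive _)

  ⟦_⟧± : Sign → Carrier
  ⟦ Sign.+ ⟧± = 1#
  ⟦ Sign.- ⟧± = - 1#

  sign-homo : ∀ s t → ⟦ s Sign.* t ⟧± ≈ ⟦ s ⟧± * ⟦ t ⟧±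
  sign-homo Sign.+ t      = sym (*-identityˡ _)
  sign-homo Sign.- Sign.+ = sym (*-identityʳ _)
  sign-homo Sign.- Sign.- = sym (trans (-1*x≈-x (- 1#)) (-‿involutive 1#))

  ◃-homo : ∀ s n → ⟦ s ℤ.◃ n ⟧ℤ ≈ ⟦ s ⟧± * (n ×ᴿ 1#)
  ◃-homo s      zero    = sym (zeroʳ _)
  ◃-homo Sign.+ (suc n) = sym (*-identityˡ _)
  ◃-homo Sign.- (suc n) = sym (-1*x≈-x _)

  sign-abs : ∀ i → ⟦ i ⟧ℤ ≈ ⟦ ℤ.sign i ⟧± * (ℤ.∣ i ∣ ×ᴿ 1#)
  sign-abs i = trans (reflexive (≡.cong ⟦_⟧ℤ (≡.sym (ℤ.◃-inverse i)))) (◃-homo (ℤ.sign i) ℤ.∣ i ∣)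

  *-homo : ∀ i j → ⟦ i ℤ.* j ⟧ℤ ≈ ⟦ i ⟧ℤ * ⟦ j ⟧ℤ
  *-homo i j = begin
    ⟦ ℤ.sign i Sign.* ℤ.sign j ℤ.◃ ℤ.∣ i ∣ ℕ.* ℤ.∣ j ∣ ⟧ℤ
      ≈⟨ ◃-homo (ℤ.sign i Sign.* ℤ.sign j) (ℤ.∣ i ∣ ℕ.* ℤ.∣ j ∣) ⟩
    ⟦ ℤ.sign i Sign.* ℤ.sign j ⟧± * ((ℤ.∣ i ∣ ℕ.* ℤ.∣ j ∣) ×ᴿ 1#)
      ≈⟨ *-cong (sign-homo (ℤ.sign i) (ℤ.sign j)) (×1-homo-* ℤ.∣ i ∣ ℤ.∣ j ∣) ⟩
    (⟦ ℤ.sign i ⟧± * ⟦ ℤ.sign j ⟧±) * ((ℤ.∣ i ∣ ×ᴿ 1#) * (ℤ.∣ j ∣ ×ᴿ 1#))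
      ≈⟨ interchange _ _ _ _ ⟩
    (⟦ ℤ.sign i ⟧± * (ℤ.∣ i ∣ ×ᴿ 1#)) * (⟦ ℤ.sign j ⟧± * (ℤ.∣ j ∣ ×ᴿ 1#))
      ≈⟨ *-cong (sign-abs i) (sign-abs j) ⟨
    ⟦ i ⟧ℤ * ⟦ j ⟧ℤ ∎

  ℤ-morphism : ℤ-rawRing -Raw-AlmostCommutative⟶ fromCommutativeRing R
  ℤ-morphism = record
    { ⟦_⟧ = ⟦_⟧ℤ ; +-homo = +-homo ; *-homo = *-homo ; -‿homo = -‿homo
    ; 0-homo = refl ; 1-homo = refl }

  ℤ-≟ : ∀ i j → Maybe.Maybe (⟦ i ⟧ℤ ≈ ⟦ j ⟧ℤ)
  ℤ-≟ i j = Maybe.map (λ i≡j → reflexive (≡.cong ⟦_⟧ℤ i≡j)) (dec⇒maybe (i ℤ.≟ j))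

  open import Algebra.Solver.Ring ℤ-rawRing (fromCommutativeRing R) ℤ-morphism ℤ-≟ public

  polynomials : ℕ → RawRing 0ℓ 0ℓ
  polynomials n = record
    { Carrier = Polynomial n ; _≈_ = _≡_ ; _+_ = _:+_ ; _*_ = _:*_ ; -_ = :-_
    ; 0# = con (+ 0) ; 1# = con (+ 1) }

module FiniteSums {c ℓ} (R : CommutativeRing c ℓ) where
  open CommutativeRing R
  open import Algebra.Properties.CommutativeSemigroup +-commutativeSemigroup using (interchange)
  open import Algebra.Properties.Ring ring using (-0#≈0#; -‿+-comm)
  open import Relation.Binary.Reasoning.Setoid setoid

  ∑ : (n : ℕ) → (Fin n → Carrier) → Carrier
  ∑ = sumF R

  ∑-cong : ∀ n {f g : Fin n → Carrier} → (∀ i → f i ≈ g i) → ∑ n f ≈ ∑ n g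
  ∑-cong zero    f≈g = refl
  ∑-cong (suc n) f≈g = +-cong (f≈g f0) (∑-cong n (λ i → f≈g (fs i)))

  ∑-zero : ∀ n → ∑ n (λ _ → 0#) ≈ 0#
  ∑-zero zero    = refl
  ∑-zero (suc n) = trans (+-identityˡ _) (∑-zero n)

  ∑-+ : ∀ n (f g : Fin n → Carrier) → ∑ n (λ i → f i + g i) ≈ ∑ n f + ∑ n g
  ∑-+ zero    f g = sym (+-identityˡ 0#)
  ∑-+ (suc n) f g = trans (+-congˡ (∑-+ n _ _)) (interchange _ _ _ _)

  ∑-neg : ∀ n (f : Fin n → Carrier) → ∑ n (λ i → - f i) ≈ - ∑ n f
  ∑-neg zero    f = sym -0#≈0#
  ∑-neg (suc n) f = trans (+-congˡ (∑-neg n _)) (-‿+-comm _ _)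

  ∑-- : ∀ n (f g : Fin n → Carrier) → ∑ n (λ i → f i - g i) ≈ ∑ n f - ∑ n g
  ∑-- n f g = trans (∑-+ n f _) (+-congˡ (∑-neg n g))

  ∑-*ˡ : ∀ n x (f : Fin n → Carrier) → x * ∑ n f ≈ ∑ n (λ i → x * f i)
  ∑-*ˡ zero    x f = zeroʳ x
  ∑-*ˡ (suc n) x f = trans (distribˡ x _ _) (+-congˡ (∑-*ˡ n x _))

  ∑-*ʳ : ∀ n x (f : Fin n → Carrier) → ∑ n f * x ≈ ∑ n (λ i → f i * x)
  ∑-*ʳ n x f = trans (*-comm _ x) (trans (∑-*ˡ n x f) (∑-cong n (λ i → *-comm x (f i))))

  ∑-comm : ∀ m n (f : Fin m → Fin n → Carrier) →
           ∑ m (λ i → ∑ n (f i)) ≈ ∑ n (λ j → ∑ m (λ i → f i j))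
  ∑-comm zero    n f = sym (∑-zero n)
  ∑-comm (suc m) n f = begin
    ∑ n (f f0) + ∑ m (λ i → ∑ n (f (fs i)))         ≈⟨ +-congˡ (∑-comm m n (λ i → f (fs i))) ⟩
    ∑ n (f f0) + ∑ n (λ j → ∑ m (λ i → f (fs i) j)) ≈⟨ ∑-+ n _ _ ⟨
    ∑ n (λ j → f f0 j + ∑ m (λ i → f (fs i) j))     ∎

  ∑-single : ∀ n (f : Fin n → Carrier) i₀ → (∀ i → i ≢ i₀ → f i ≈ 0#) → ∑ n f ≈ f i₀
  ∑-single (suc n) f f0 f≈0 =
    trans (+-congˡ (trans (∑-cong n (λ i → f≈0 (fs i) (λ ()))) (∑-zero n))) (+-identityʳ _)
  ∑-single (suc n) f (fs i₀) f≈0 = trans (+-cong (f≈0 f0 (λ ())) tail≈fᵢ₀) (+-identityˡ _)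
    where
    tail≈fᵢ₀ : ∑ n (λ i → f (fs i)) ≈ f (fs i₀)
    tail≈fᵢ₀ = ∑-single n (λ i → f (fs i)) i₀ (λ i i≢i₀ → f≈0 (fs i) (i≢i₀ ∘ Fin.suc-injective))

  ∑∑-assoc : ∀ n (A B C : Fin n → Fin n → Carrier) i j →
    ∑ n (λ l → ∑ n (λ k → A i k * B k l) * C l j) ≈ ∑ n (λ k → A i k * ∑ n (λ l → B k l * C l j))
  ∑∑-assoc n A B C i j = begin
    ∑ n (λ l → ∑ n (λ k → A i k * B k l) * C l j)   ≈⟨ ∑-cong n (λ l → ∑-*ʳ n (C l j) _) ⟩
    ∑ n (λ l → ∑ n (λ k → A i k * B k l * C l j))   ≈⟨ ∑-comm n n _ ⟩
    ∑ n (λ k → ∑ n (λ l → A i k * B k l * C l j))   ≈⟨ ∑-cong n (λ k → ∑-cong n (λ l → *-assoc _ _ _)) ⟩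
    ∑ n (λ k → ∑ n (λ l → A i k * (B k l * C l j))) ≈⟨ ∑-cong n (λ k → ∑-*ˡ n (A i k) _) ⟨
    ∑ n (λ k → A i k * ∑ n (λ l → B k l * C l j))   ∎

module RawMatrices {c ℓ} (R : RawRing c ℓ) where
  open RawRing R

  I₄ : Fin 4 → Fin 4 → Carrier
  I₄ f0                f0                = 1#
  I₄ (fs f0)           (fs f0)           = 1#
  I₄ (fs (fs f0))      (fs (fs f0))      = 1#
  I₄ (fs (fs (fs f0))) (fs (fs (fs f0))) = 1#
  I₄ _                 _                 = 0#

  infixl 7 _·_
  _·_ : (Fin 4 → Fin 4 → Carrier) → (Fin 4 → Fin 4 → Carrier) → Fin 4 → Fin 4 → Carrier
  (A · B) i j = A i (# 0) * B (# 0) j + (A i (# 1) * B (# 1) j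
              + (A i (# 2) * B (# 2) j + (A i (# 3) * B (# 3) j + 0#)))

module Matrices {c ℓ} (R : CommutativeRing c ℓ) where
  open CommutativeRing R
  open FiniteSums R
  open IntegerCoefficients R using (Polynomial; polynomials; var; ⟦_⟧; ⟦_⟧↓; prove)
  module P = RawMatrices (polynomials 4)
  open import Relation.Binary.Reasoning.Setoid setoid

  infix 4 _≈ₘ_
  _≈ₘ_ : Mat R → Mat R → Set ℓ
  _≈ₘ_ = _≈M_ R

  infixl 7 _*ₘ_
  _*ₘ_ : Mat R → Mat R → Mat R
  _*ₘ_ = _*M_ R

  ≈ₘ-refl : ∀ {A} → A ≈ₘ A
  ≈ₘ-refl i j = refl

  ≈ₘ-sym : ∀ {A B} → A ≈ₘ B → B ≈ₘ A
  ≈ₘ-sym A≈B i j = sym (A≈B i j)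

  ≈ₘ-trans : ∀ {A B C} → A ≈ₘ B → B ≈ₘ C → A ≈ₘ C
  ≈ₘ-trans A≈B B≈C i j = trans (A≈B i j) (B≈C i j)

  ≈ₘ-setoid : Setoid c ℓ
  ≈ₘ-setoid = record
    { Carrier = Mat R ; _≈_ = _≈ₘ_
    ; isEquivalence = record { refl = ≈ₘ-refl ; sym = ≈ₘ-sym ; trans = ≈ₘ-trans } }

  *ₘ-cong : ∀ {A A' B B'} → A ≈ₘ A' → B ≈ₘ B' → A *ₘ B ≈ₘ A' *ₘ B'
  *ₘ-cong A≈A' B≈B' i j = ∑-cong 4 (λ k → *-cong (A≈A' i k) (B≈B' k j))

  *ₘ-congˡ : ∀ A {B B'} → B ≈ₘ B' → A *ₘ B ≈ₘ A *ₘ B'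
  *ₘ-congˡ A = *ₘ-cong {A} {A} ≈ₘ-refl

  *ₘ-congʳ : ∀ {A A'} B → A ≈ₘ A' → A *ₘ B ≈ₘ A' *ₘ B
  *ₘ-congʳ {A} {A'} B A≈A' = *ₘ-cong {A} {A'} {B} {B} A≈A' ≈ₘ-refl

  *ₘ-assoc : ∀ A B C → (A *ₘ B) *ₘ C ≈ₘ A *ₘ (B *ₘ C)
  *ₘ-assoc A B C = ∑∑-assoc 4 A B C

  𝟙 : Mat R
  𝟙 = IdM R

  *ₘ-identityˡ : ∀ A → 𝟙 *ₘ A ≈ₘ A
  *ₘ-identityˡ A i j = row i
    where
    ρ : Vec Carrier 4
    ρ = A (# 0) j ∷ A (# 1) j ∷ A (# 2) j ∷ A (# 3) j ∷ []
    column : Fin 4 → Fin 4 → Polynomial 4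
    column k _ = var k
    entry : ∀ i → ⟦ (P.I₄ P.· column) i f0 ⟧↓ ρ ≈ ⟦ column i f0 ⟧↓ ρ
          → ⟦ (P.I₄ P.· column) i f0 ⟧ ρ ≈ ⟦ column i f0 ⟧ ρ
    entry i = prove ρ ((P.I₄ P.· column) i f0) (column i f0)
    row : ∀ i → (𝟙 *ₘ A) i j ≈ A i j
    row f0                = entry f0 refl
    row (fs f0)           = entry (fs f0) refl
    row (fs (fs f0))      = entry (fs (fs f0)) refl
    row (fs (fs (fs f0))) = entry (fs (fs (fs f0))) refl

  *ₘ-identityʳ : ∀ A → A *ₘ 𝟙 ≈ₘ A
  *ₘ-identityʳ A i j = column j
    where
    ρ : Vec Carrier 4
    ρ = A i (# 0) ∷ A i (# 1) ∷ A i (# 2) ∷ A i (# 3) ∷ []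
    row : Fin 4 → Fin 4 → Polynomial 4
    row _ k = var k
    entry : ∀ j → ⟦ (row P.· P.I₄) f0 j ⟧↓ ρ ≈ ⟦ row f0 j ⟧↓ ρ
          → ⟦ (row P.· P.I₄) f0 j ⟧ ρ ≈ ⟦ row f0 j ⟧ ρ
    entry j = prove ρ ((row P.· P.I₄) f0 j) (row f0 j)
    column : ∀ j → (A *ₘ 𝟙) i j ≈ A i j
    column f0                = entry f0 refl
    column (fs f0)           = entry (fs f0) refl
    column (fs (fs f0))      = entry (fs (fs f0)) refl
    column (fs (fs (fs f0))) = entry (fs (fs (fs f0))) refl

record Coords {ℓ} (A : Set ℓ) : Set ℓ where
  constructor ⟨_,_,_,_⟩
  field
    a b c t : A

-- Over a raw ring, so that the same formulas can be instantiated with the solver's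
-- polynomial expressions, whose evaluation gives back the field formulas definitionally.
module CoordinateFormulas {c ℓ} (R : RawRing c ℓ) where
  open RawRing R
  open RawMatrices R public

  infixl 6 _-_
  _-_ : Carrier → Carrier → Carrier
  x - y = x + - y

  E⟨_⟩ : Coords Carrier → Fin 4 → Fin 4 → Carrier
  E⟨ g ⟩ f0                f0                = 1#
  E⟨ g ⟩ f0                _                 = 0#
  E⟨ g ⟩ (fs f0)           f0                = - Coords.c g
  E⟨ g ⟩ (fs f0)           (fs f0)           = 1#
  E⟨ g ⟩ (fs f0)           _                 = 0#
  E⟨ g ⟩ (fs (fs f0))      f0                = Coords.b g - Coords.c g * Coords.t g
  E⟨ g ⟩ (fs (fs f0))      (fs f0)           = Coords.t g
  E⟨ g ⟩ (fs (fs f0))      (fs (fs f0))      = 1#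
  E⟨ g ⟩ (fs (fs f0))      _                 = 0#
  E⟨ g ⟩ (fs (fs (fs f0))) f0                = Coords.a g
  E⟨ g ⟩ (fs (fs (fs f0))) (fs f0)           = Coords.b g
  E⟨ g ⟩ (fs (fs (fs f0))) (fs (fs f0))      = Coords.c g
  E⟨ g ⟩ (fs (fs (fs f0))) (fs (fs (fs f0))) = 1#

  infixl 7 _∙_
  _∙_ : Coords Carrier → Coords Carrier → Coords Carrier
  ⟨ a , b , c , t ⟩ ∙ ⟨ a' , b' , c' , t' ⟩ =
    ⟨ a + a' + c * b' - (b * c' + c * c' * t') , b + b' + c * t' , c + c' , t + t' ⟩

  infix 8 _⁻¹
  _⁻¹ : Coords Carrier → Coords Carrier
  ⟨ a , b , c , t ⟩ ⁻¹ = ⟨ - a , c * t - b , - c , - t ⟩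

  ε : Coords Carrier
  ε = ⟨ 0# , 0# , 0# , 0# ⟩

  [_,_] : Coords Carrier → Coords Carrier → Coords Carrier
  [ g , h ] = g ⁻¹ ∙ h ⁻¹ ∙ g ∙ h

module EMatrices {c ℓ} (F : CommutativeRing c ℓ) where
  open CommutativeRing F
  open IntegerCoefficients F
    using (Polynomial; polynomials; var; con; _:+_; _:*_; :-_; _:-_; ⟦_⟧; ⟦_⟧↓; prove; solve; _:=_)
  open Matrices F
  open CoordinateFormulas rawRing using (_∙_; _⁻¹; ε; [_,_])
  open import Algebra.Properties.Ring ring using (-0#≈0#; -‿injective)

  module Poly {n} = CoordinateFormulas (polynomials n)

  Eᶜ : Coords Carrier → Mat F
  Eᶜ ⟨ a , b , c , t ⟩ = E F a b c t

  infix 4 _≈C_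
  _≈C_ : Coords Carrier → Coords Carrier → Set ℓ
  ⟨ a , b , c , t ⟩ ≈C ⟨ a' , b' , c' , t' ⟩ = a ≈ a' × b ≈ b' × c ≈ c' × t ≈ t'

  ⟦_⟧C ⟦_⟧C↓ : ∀ {n} → Coords (Polynomial n) → Vec Carrier n → Coords Carrier
  ⟦ ⟨ a , b , c , t ⟩ ⟧C  ρ = ⟨ ⟦ a ⟧ ρ , ⟦ b ⟧ ρ , ⟦ c ⟧ ρ , ⟦ t ⟧ ρ ⟩
  ⟦ ⟨ a , b , c , t ⟩ ⟧C↓ ρ = ⟨ ⟦ a ⟧↓ ρ , ⟦ b ⟧↓ ρ , ⟦ c ⟧↓ ρ , ⟦ t ⟧↓ ρ ⟩

  proveCoords : ∀ {n} (ρ : Vec Carrier n) x y → ⟦ x ⟧C↓ ρ ≡ ⟦ y ⟧C↓ ρ → ⟦ x ⟧C ρ ≈C ⟦ y ⟧C ρ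
  proveCoords ρ ⟨ a , b , c , t ⟩ ⟨ a' , b' , c' , t' ⟩ x↓≡y↓ =
    prove ρ a a' (reflexive (≡.cong Coords.a x↓≡y↓)) , prove ρ b b' (reflexive (≡.cong Coords.b x↓≡y↓)) ,
    prove ρ c c' (reflexive (≡.cong Coords.c x↓≡y↓)) , prove ρ t t' (reflexive (≡.cong Coords.t x↓≡y↓))

  Eᶜ-cong : ∀ {g h} → g ≈C h → Eᶜ g ≈ₘ Eᶜ h
  Eᶜ-cong _                    f0           f0                = refl
  Eᶜ-cong _                    f0           (fs _)            = refl
  Eᶜ-cong (_ , _ , c≈ , _)     (fs f0)      f0                = -‿cong c≈
  Eᶜ-cong _                    (fs f0)      (fs f0)           = refl
  Eᶜ-cong _                    (fs f0)      (fs (fs _))       = refl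
  Eᶜ-cong (_ , b≈ , c≈ , t≈)   (fs (fs f0)) f0                = +-cong b≈ (-‿cong (*-cong c≈ t≈))
  Eᶜ-cong (_ , _ , _ , t≈)     (fs (fs f0)) (fs f0)           = t≈
  Eᶜ-cong _                    (fs (fs f0)) (fs (fs f0))      = refl
  Eᶜ-cong _                    (fs (fs f0)) (fs (fs (fs _)))  = refl
  Eᶜ-cong (a≈ , _ , _ , _)     (fs (fs (fs f0))) f0           = a≈
  Eᶜ-cong (_ , b≈ , _ , _)     (fs (fs (fs f0))) (fs f0)      = b≈
  Eᶜ-cong (_ , _ , c≈ , _)     (fs (fs (fs f0))) (fs (fs f0)) = c≈
  Eᶜ-cong _                    (fs (fs (fs f0))) (fs (fs (fs f0))) = refl

  Eᶜ-ε : Eᶜ ε ≈ₘ 𝟙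
  Eᶜ-ε f0                f0                = refl
  Eᶜ-ε f0                (fs _)            = refl
  Eᶜ-ε (fs f0)           f0                = -0#≈0#
  Eᶜ-ε (fs f0)           (fs f0)           = refl
  Eᶜ-ε (fs f0)           (fs (fs _))       = refl
  Eᶜ-ε (fs (fs f0))      f0                = trans (+-identityˡ _) (trans (-‿cong (zeroˡ 0#)) -0#≈0#)
  Eᶜ-ε (fs (fs f0))      (fs f0)           = refl
  Eᶜ-ε (fs (fs f0))      (fs (fs f0))      = refl
  Eᶜ-ε (fs (fs f0))      (fs (fs (fs _)))  = refl
  Eᶜ-ε (fs (fs (fs f0))) f0                = refl
  Eᶜ-ε (fs (fs (fs f0))) (fs f0)           = refl
  Eᶜ-ε (fs (fs (fs f0))) (fs (fs f0))      = refl
  Eᶜ-ε (fs (fs (fs f0))) (fs (fs (fs f0))) = refl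

  module Variables where
    A B C T A' B' C' T' Z : Polynomial 8
    A  = var (# 0)
    B  = var (# 1)
    C  = var (# 2)
    T  = var (# 3)
    A' = var (# 4)
    B' = var (# 5)
    C' = var (# 6)
    T' = var (# 7)
    Z  = con (+ 0)

    X Y : Coords (Polynomial 8)
    X = ⟨ A , B , C , T ⟩
    Y = ⟨ A' , B' , C' , T' ⟩

  env : Coords Carrier → Coords Carrier → Vec Carrier 8
  env ⟨ a , b , c , t ⟩ ⟨ a' , b' , c' , t' ⟩ = a ∷ b ∷ c ∷ t ∷ a' ∷ b' ∷ c' ∷ t' ∷ []

  Eᶜ-∙ : ∀ g h → Eᶜ g *ₘ Eᶜ h ≈ₘ Eᶜ (g ∙ h)
  Eᶜ-∙ g h = entries
    where
    open Variables using (X; Y)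
    ρ : Vec Carrier 8
    ρ = env g h
    entry : ∀ i j → ⟦ (Poly.E⟨ X ⟩ Poly.· Poly.E⟨ Y ⟩) i j ⟧↓ ρ ≈ ⟦ Poly.E⟨ X Poly.∙ Y ⟩ i j ⟧↓ ρ
          → ⟦ (Poly.E⟨ X ⟩ Poly.· Poly.E⟨ Y ⟩) i j ⟧ ρ ≈ ⟦ Poly.E⟨ X Poly.∙ Y ⟩ i j ⟧ ρ
    entry i j = prove ρ ((Poly.E⟨ X ⟩ Poly.· Poly.E⟨ Y ⟩) i j) (Poly.E⟨ X Poly.∙ Y ⟩ i j)
    entries : Eᶜ g *ₘ Eᶜ h ≈ₘ Eᶜ (g ∙ h)
    entries f0                f0                = entry f0 f0 refl
    entries f0                (fs f0)           = entry f0 (fs f0) refl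
    entries f0                (fs (fs f0))      = entry f0 (fs (fs f0)) refl
    entries f0                (fs (fs (fs f0))) = entry f0 (fs (fs (fs f0))) refl
    entries (fs f0)           f0                = entry (fs f0) f0 refl
    entries (fs f0)           (fs f0)           = entry (fs f0) (fs f0) refl
    entries (fs f0)           (fs (fs f0))      = entry (fs f0) (fs (fs f0)) refl
    entries (fs f0)           (fs (fs (fs f0))) = entry (fs f0) (fs (fs (fs f0))) refl
    entries (fs (fs f0))      f0                = entry (fs (fs f0)) f0 refl
    entries (fs (fs f0))      (fs f0)           = entry (fs (fs f0)) (fs f0) refl
    entries (fs (fs f0))      (fs (fs f0))      = entry (fs (fs f0)) (fs (fs f0)) refl
    entries (fs (fs f0))      (fs (fs (fs f0))) = entry (fs (fs f0)) (fs (fs (fs f0))) refl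
    entries (fs (fs (fs f0))) f0                = entry (fs (fs (fs f0))) f0 refl
    entries (fs (fs (fs f0))) (fs f0)           = entry (fs (fs (fs f0))) (fs f0) refl
    entries (fs (fs (fs f0))) (fs (fs f0))      = entry (fs (fs (fs f0))) (fs (fs f0)) refl
    entries (fs (fs (fs f0))) (fs (fs (fs f0))) = entry (fs (fs (fs f0))) (fs (fs (fs f0))) refl

  module _ where
    open Variables

    ∙-inverseʳ : ∀ g → g ∙ g ⁻¹ ≈C ε
    ∙-inverseʳ g = proveCoords (env g ε) (X Poly.∙ X Poly.⁻¹) Poly.ε ≡.refl

    ∙-inverseˡ : ∀ g → g ⁻¹ ∙ g ≈C ε
    ∙-inverseˡ g = proveCoords (env g ε) (X Poly.⁻¹ Poly.∙ X) Poly.ε ≡.refl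

    [,]-closedForm : ∀ a b c t a' b' c' t' →
      [ ⟨ a , b , c , t ⟩ , ⟨ a' , b' , c' , t' ⟩ ]
        ≈C ⟨ (1# + 1#) * (c * b' - b * c' + c * c' * (t - t')) - c * c * t' + c' * c' * t
           , c * t' - c' * t , 0# , 0# ⟩
    [,]-closedForm a b c t a' b' c' t' = proveCoords (env ⟨ a , b , c , t ⟩ ⟨ a' , b' , c' , t' ⟩)
      Poly.[ X , Y ]
      ⟨ con (+ 2) :* (C :* B' :- B :* C' :+ C :* C' :* (T :- T')) :- C :* C :* T' :+ C' :* C' :* T
      , C :* T' :- C' :* T , Z , Z ⟩
      ≡.refl

    [AB,_]-closedForm : ∀ a b a' b' c' t' →
      [ ⟨ a , b , 0# , 0# ⟩ , ⟨ a' , b' , c' , t' ⟩ ] ≈C ⟨ - ((1# + 1#) * b * c') , 0# , 0# , 0# ⟩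
    [AB,_]-closedForm a b a' b' c' t' = proveCoords (env ⟨ a , b , 0# , 0# ⟩ ⟨ a' , b' , c' , t' ⟩)
      Poly.[ ⟨ A , B , Z , Z ⟩ , Y ] ⟨ :- (con (+ 2) :* B :* C') , Z , Z , Z ⟩ ≡.refl

    [A,_]≈ε : ∀ a a' b' c' t' → [ ⟨ a , 0# , 0# , 0# ⟩ , ⟨ a' , b' , c' , t' ⟩ ] ≈C ε
    [A,_]≈ε a a' b' c' t' = proveCoords (env ⟨ a , 0# , 0# , 0# ⟩ ⟨ a' , b' , c' , t' ⟩)
      Poly.[ ⟨ A , Z , Z , Z ⟩ , Y ] Poly.ε ≡.refl

    AB-∙ : ∀ a b a' b' → ⟨ a , b , 0# , 0# ⟩ ∙ ⟨ a' , b' , 0# , 0# ⟩ ≈C ⟨ a + a' , b + b' , 0# , 0# ⟩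
    AB-∙ a b a' b' = proveCoords (env ⟨ a , b , 0# , 0# ⟩ ⟨ a' , b' , 0# , 0# ⟩)
      (⟨ A , B , Z , Z ⟩ Poly.∙ ⟨ A' , B' , Z , Z ⟩) ⟨ A :+ A' , B :+ B' , Z , Z ⟩ ≡.refl

    AB-⁻¹ : ∀ a b → ⟨ a , b , 0# , 0# ⟩ ⁻¹ ≈C ⟨ - a , - b , 0# , 0# ⟩
    AB-⁻¹ a b = proveCoords (env ⟨ a , b , 0# , 0# ⟩ ε)
      (⟨ A , B , Z , Z ⟩ Poly.⁻¹) ⟨ :- A , :- B , Z , Z ⟩ ≡.refl

    A-∙ : ∀ a a' → ⟨ a , 0# , 0# , 0# ⟩ ∙ ⟨ a' , 0# , 0# , 0# ⟩ ≈C ⟨ a + a' , 0# , 0# , 0# ⟩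
    A-∙ a a' = proveCoords (env ⟨ a , 0# , 0# , 0# ⟩ ⟨ a' , 0# , 0# , 0# ⟩)
      (⟨ A , Z , Z , Z ⟩ Poly.∙ ⟨ A' , Z , Z , Z ⟩) ⟨ A :+ A' , Z , Z , Z ⟩ ≡.refl

    A-⁻¹ : ∀ a → ⟨ a , 0# , 0# , 0# ⟩ ⁻¹ ≈C ⟨ - a , 0# , 0# , 0# ⟩
    A-⁻¹ a = proveCoords (env ⟨ a , 0# , 0# , 0# ⟩ ε)
      (⟨ A , Z , Z , Z ⟩ Poly.⁻¹) ⟨ :- A , Z , Z , Z ⟩ ≡.refl

    ε∙ε≈ε : ε ∙ ε ≈C ε
    ε∙ε≈ε = proveCoords (env ε ε) (Poly.ε Poly.∙ Poly.ε) Poly.ε ≡.refl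

    ε⁻¹≈ε : ε ⁻¹ ≈C ε
    ε⁻¹≈ε = proveCoords (env ε ε) (Poly.ε Poly.⁻¹) Poly.ε ≡.refl

    γ₃-witness-closedForm : ∀ c t t' →
      [ [ ⟨ 0# , 0# , c , t ⟩ , ⟨ 0# , 0# , 1# , t' ⟩ ] , ⟨ 0# , 0# , 1# , t' ⟩ ]
        ≈C ⟨ - ((1# + 1#) * (c * t' - t)) , 0# , 0# , 0# ⟩
    γ₃-witness-closedForm c t t' = proveCoords (env ⟨ 0# , 0# , c , t ⟩ ⟨ 0# , 0# , 1# , t' ⟩)
      Poly.[ Poly.[ ⟨ Z , Z , C , T ⟩ , ⟨ Z , Z , con (+ 1) , T' ⟩ ] , ⟨ Z , Z , con (+ 1) , T' ⟩ ]
      ⟨ :- (con (+ 2) :* (C :* T' :- T)) , Z , Z , Z ⟩ ≡.refl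

    γ₂-witness-closedForm : ∀ t t' →
      [ ⟨ 0# , 1# , 0# , t ⟩ , ⟨ 0# , 0# , 1# , t' ⟩ ] ≈C ⟨ t - (1# + 1#) , - t , 0# , 0# ⟩
    γ₂-witness-closedForm t t' = proveCoords (env ⟨ 0# , 1# , 0# , t ⟩ ⟨ 0# , 0# , 1# , t' ⟩)
      Poly.[ ⟨ Z , con (+ 1) , Z , T ⟩ , ⟨ Z , Z , con (+ 1) , T' ⟩ ] ⟨ T :- con (+ 2) , :- T , Z , Z ⟩ ≡.refl

  Eᶜ-inverseʳ : ∀ g → Eᶜ g *ₘ Eᶜ (g ⁻¹) ≈ₘ 𝟙
  Eᶜ-inverseʳ g = ≈ₘ-trans (Eᶜ-∙ g (g ⁻¹)) (≈ₘ-trans (Eᶜ-cong (∙-inverseʳ g)) Eᶜ-ε)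

  Eᶜ-inverseˡ : ∀ g → Eᶜ (g ⁻¹) *ₘ Eᶜ g ≈ₘ 𝟙
  Eᶜ-inverseˡ g = ≈ₘ-trans (Eᶜ-∙ (g ⁻¹) g) (≈ₘ-trans (Eᶜ-cong (∙-inverseˡ g)) Eᶜ-ε)

  Eᶜ-rightInverse-unique : ∀ {x y} g → x ≈ₘ Eᶜ g → x *ₘ y ≈ₘ 𝟙 → y ≈ₘ Eᶜ (g ⁻¹)
  Eᶜ-rightInverse-unique {x} {y} g x≈ xy≈𝟙 = begin
    y                           ≈⟨ *ₘ-identityˡ y ⟨
    𝟙 *ₘ y                      ≈⟨ *ₘ-congʳ y (Eᶜ-inverseˡ g) ⟨
    (Eᶜ (g ⁻¹) *ₘ Eᶜ g) *ₘ y    ≈⟨ *ₘ-congʳ y (*ₘ-congˡ (Eᶜ (g ⁻¹)) x≈) ⟨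
    (Eᶜ (g ⁻¹) *ₘ x) *ₘ y       ≈⟨ *ₘ-assoc (Eᶜ (g ⁻¹)) x y ⟩
    Eᶜ (g ⁻¹) *ₘ (x *ₘ y)       ≈⟨ *ₘ-congˡ (Eᶜ (g ⁻¹)) xy≈𝟙 ⟩
    Eᶜ (g ⁻¹) *ₘ 𝟙              ≈⟨ *ₘ-identityʳ (Eᶜ (g ⁻¹)) ⟩
    Eᶜ (g ⁻¹)                   ∎
    where open import Relation.Binary.Reasoning.Setoid ≈ₘ-setoid

  Eᶜ-[,] : ∀ g h → ((Eᶜ (g ⁻¹) *ₘ Eᶜ (h ⁻¹)) *ₘ Eᶜ g) *ₘ Eᶜ h ≈ₘ Eᶜ [ g , h ]
  Eᶜ-[,] g h = ≈ₘ-trans (*ₘ-congʳ (Eᶜ h) (≈ₘ-trans (*ₘ-congʳ (Eᶜ g) (Eᶜ-∙ (g ⁻¹) (h ⁻¹))) (Eᶜ-∙ _ g)))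
                       (Eᶜ-∙ _ h)

  Eᶜ-IsComm : ∀ g h → IsComm F (Eᶜ g) (Eᶜ h) (Eᶜ [ g , h ])
  Eᶜ-IsComm g h = Eᶜ (g ⁻¹) , Eᶜ (h ⁻¹) , Eᶜ-inverseʳ g , Eᶜ-inverseʳ h , ≈ₘ-sym (Eᶜ-[,] g h)

  IsComm⇒≈Eᶜ[,] : ∀ {x y z} g h → x ≈ₘ Eᶜ g → y ≈ₘ Eᶜ h → IsComm F x y z → z ≈ₘ Eᶜ [ g , h ]
  IsComm⇒≈Eᶜ[,] {x} {y} g h x≈ y≈ (x' , y' , xx'≈𝟙 , yy'≈𝟙 , z≈) =
    ≈ₘ-trans z≈ (≈ₘ-trans (*ₘ-cong (*ₘ-cong (*ₘ-cong x'≈ y'≈) x≈) y≈) (Eᶜ-[,] g h))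
    where
    x'≈ : x' ≈ₘ Eᶜ (g ⁻¹)
    x'≈ = Eᶜ-rightInverse-unique g x≈ xx'≈𝟙
    y'≈ : y' ≈ₘ Eᶜ (h ⁻¹)
    y'≈ = Eᶜ-rightInverse-unique h y≈ yy'≈𝟙

  EImage : (Coords Carrier → Set c) → Mat F → Set (c ⊔ ℓ)
  EImage P M = ∃[ g ] (P g × M ≈ₘ Eᶜ g)

  record IsClosed (P : Coords Carrier → Set c) : Set (c ⊔ ℓ) where
    field
      contains-ε : P ε
      closed-∙   : ∀ {g h} → P g → P h → ∃[ k ] (P k × g ∙ h ≈C k)
      closed-⁻¹  : ∀ {g} → P g → ∃[ k ] (P k × g ⁻¹ ≈C k)

  Gen⊆EImage : ∀ {P S} → IsClosed P → (∀ {M} → S M → EImage P M) → ∀ {M} → Gen F S M → EImage P M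
  Gen⊆EImage {P} {S} closed S⊆ = go
    where
    open IsClosed closed
    go : ∀ {M} → Gen F S M → EImage P M
    go (gen s) = S⊆ s
    go one = ε , contains-ε , ≈ₘ-sym Eᶜ-ε
    go (mul x∈ y∈) =
      let (g , Pg , x≈) = go x∈
          (h , Ph , y≈) = go y∈
          (k , Pk , gh≈k) = closed-∙ Pg Ph
      in  k , Pk , ≈ₘ-trans (*ₘ-cong x≈ y≈) (≈ₘ-trans (Eᶜ-∙ g h) (Eᶜ-cong gh≈k))
    go (inv x∈ xy≈𝟙) =
      let (g , Pg , x≈) = go x∈
          (k , Pk , g⁻¹≈k) = closed-⁻¹ Pg
      in  k , Pk , ≈ₘ-trans (Eᶜ-rightInverse-unique g x≈ xy≈𝟙) (Eᶜ-cong g⁻¹≈k)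
    go (resp x∈ x≈y) =
      let (g , Pg , x≈) = go x∈
      in  g , Pg , ≈ₘ-trans (≈ₘ-sym x≈y) x≈

  Commutators : (Mat F → Set (c ⊔ ℓ)) → (Mat F → Set (c ⊔ ℓ)) → Mat F → Set (c ⊔ ℓ)
  Commutators X Y z = ∃[ x ] ∃[ y ] (X x × Y y × IsComm F x y z)

  Gen-Commutators⊆EImage : ∀ {P Q R X Y} → IsClosed Q
    → (∀ {g h} → P g → R h → ∃[ k ] (Q k × [ g , h ] ≈C k))
    → (∀ {x} → X x → EImage P x) → (∀ {y} → Y y → EImage R y)
    → ∀ {z} → Gen F (Commutators X Y) z → EImage Q z
  Gen-Commutators⊆EImage Q-closed [P,R]⊆Q X⊆ Y⊆ = Gen⊆EImage Q-closed λ (x , y , x∈ , y∈ , comm) →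
    let (g , Pg , x≈) = X⊆ x∈
        (h , Rh , y≈) = Y⊆ y∈
        (k , Qk , [g,h]≈k) = [P,R]⊆Q Pg Rh
    in  k , Qk , ≈ₘ-trans (IsComm⇒≈Eᶜ[,] g h x≈ y≈ comm) (Eᶜ-cong [g,h]≈k)

  AB-form A-form : Coords Carrier → Set c
  AB-form g = ∃[ a ] ∃[ b ] (g ≡ ⟨ a , b , 0# , 0# ⟩)
  A-form g = ∃[ a ] (g ≡ ⟨ a , 0# , 0# , 0# ⟩)

  AB-closed : IsClosed AB-form
  AB-closed = record
    { contains-ε = 0# , 0# , ≡.refl
    ; closed-∙   = λ { (a , b , ≡.refl) (a' , b' , ≡.refl) → _ , (a + a' , b + b' , ≡.refl) , AB-∙ a b a' b' }
    ; closed-⁻¹  = λ { (a , b , ≡.refl) → _ , (- a , - b , ≡.refl) , AB-⁻¹ a b }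
    }

  A-closed : IsClosed A-form
  A-closed = record
    { contains-ε = 0# , ≡.refl
    ; closed-∙   = λ { (a , ≡.refl) (a' , ≡.refl) → _ , (a + a' , ≡.refl) , A-∙ a a' }
    ; closed-⁻¹  = λ { (a , ≡.refl) → _ , (- a , ≡.refl) , A-⁻¹ a }
    }

  trivial-closed : IsClosed (_≡ ε)
  trivial-closed = record
    { contains-ε = ≡.refl
    ; closed-∙   = λ { ≡.refl ≡.refl → ε , ≡.refl , ε∙ε≈ε }
    ; closed-⁻¹  = λ { ≡.refl → ε , ≡.refl , ε⁻¹≈ε }
    }

  EImage-ε⇒≈𝟙 : ∀ {M} → EImage (_≡ ε) M → M ≈ₘ 𝟙
  EImage-ε⇒≈𝟙 (_ , ≡.refl , M≈) = ≈ₘ-trans M≈ Eᶜ-ε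

  Eᶜ≈𝟙⇒a≈0 : ∀ {g} → Eᶜ g ≈ₘ 𝟙 → Coords.a g ≈ 0#
  Eᶜ≈𝟙⇒a≈0 E≈𝟙 = E≈𝟙 (# 3) (# 0)

  module Graph (S : Carrier → Carrier) where

    Graph : Mat F → Set (c ⊔ ℓ)
    Graph M = ∃[ a ] ∃[ b ] ∃[ x ] (M ≈ₘ E F a b x (S x))

    OnGraph : Coords Carrier → Set c
    OnGraph g = ∃[ a ] ∃[ b ] ∃[ x ] (g ≡ ⟨ a , b , x , S x ⟩)

    Graph⊆EImage : ∀ {M} → Graph M → EImage OnGraph M
    Graph⊆EImage (a , b , x , M≈) = ⟨ a , b , x , S x ⟩ , (a , b , x , ≡.refl) , M≈

    γ₂⊆AB : ∀ {z} → LCS F Graph 2 z → EImage AB-form z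
    γ₂⊆AB = Gen-Commutators⊆EImage AB-closed
      (λ { (a , b , c , ≡.refl) (a' , b' , c' , ≡.refl) →
             _ , (_ , _ , ≡.refl) , [,]-closedForm a b c (S c) a' b' c' (S c') })
      Graph⊆EImage Graph⊆EImage

    γ₃⊆A : ∀ {z} → LCS F Graph 3 z → EImage A-form z
    γ₃⊆A = Gen-Commutators⊆EImage A-closed
      (λ { (a , b , ≡.refl) (a' , b' , c' , ≡.refl) → _ , (_ , ≡.refl) , [AB,_]-closedForm a b a' b' c' (S c') })
      γ₂⊆AB Graph⊆EImage

    γ₄≈𝟙 : ∀ z → LCS F Graph 4 z → z ≈ₘ 𝟙
    γ₄≈𝟙 z z∈ = EImage-ε⇒≈𝟙 (Gen-Commutators⊆EImage trivial-closed
      (λ { (a , ≡.refl) (a' , b' , c' , ≡.refl) → ε , ≡.refl , [A,_]≈ε a a' b' c' (S c') })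
      γ₃⊆A Graph⊆EImage z∈)

    module Linear (κ : Carrier) (S≈κ* : ∀ x → S x ≈ κ * x) where

      S-symmetric : ∀ c c' → c * S c' - c' * S c ≈ 0#
      S-symmetric c c' = trans (+-cong (*-congˡ (S≈κ* c')) (-‿cong (*-congˡ (S≈κ* c))))
        (solve 3 (λ κ c c' → c :* (κ :* c') :- c' :* (κ :* c) := con (+ 0)) refl κ c c')

      γ₂⊆A : ∀ {z} → LCS F Graph 2 z → EImage A-form z
      γ₂⊆A = Gen-Commutators⊆EImage A-closed
        (λ { (a , b , c , ≡.refl) (a' , b' , c' , ≡.refl) →
               let (a≈ , b≈ , c≈ , t≈) = [,]-closedForm a b c (S c) a' b' c' (S c')
               in  _ , (_ , ≡.refl) , a≈ , trans b≈ (S-symmetric c c') , c≈ , t≈ })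
        Graph⊆EImage Graph⊆EImage

      γ₃≈𝟙 : ∀ z → LCS F Graph 3 z → z ≈ₘ 𝟙
      γ₃≈𝟙 z z∈ = EImage-ε⇒≈𝟙 (Gen-Commutators⊆EImage trivial-closed
        (λ { (a , ≡.refl) (a' , b' , c' , ≡.refl) → ε , ≡.refl , [A,_]≈ε a a' b' c' (S c') })
        γ₂⊆A Graph⊆EImage z∈)

    Eᶜ∈Graph : ∀ a b x → Graph (Eᶜ ⟨ a , b , x , S x ⟩)
    Eᶜ∈Graph a b x = a , b , x , ≈ₘ-refl

    γ₂-nontrivial : S 0# ≈ 0# → ¬ (1# + 1# ≈ 0#) → ∃[ z ] (LCS F Graph 2 z × ¬ (z ≈ₘ 𝟙))
    γ₂-nontrivial S0≈0 2≉0 =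
      Eᶜ [ g , h ] , gen (Eᶜ g , Eᶜ h , Eᶜ∈Graph 0# 1# 0# , Eᶜ∈Graph 0# 0# 1# , Eᶜ-IsComm g h) , nontrivial
      where
      g h : Coords Carrier
      g = ⟨ 0# , 1# , 0# , S 0# ⟩
      h = ⟨ 0# , 0# , 1# , S 1# ⟩
      nontrivial : ¬ (Eᶜ [ g , h ] ≈ₘ 𝟙)
      nontrivial [g,h]≈𝟙 = 2≉0 (-‿injective (begin
        - (1# + 1#)           ≈⟨ +-identityˡ _ ⟨
        0# - (1# + 1#)        ≈⟨ +-congʳ S0≈0 ⟨
        S 0# - (1# + 1#)      ≈⟨ proj₁ (γ₂-witness-closedForm (S 0#) (S 1#)) ⟨
        Coords.a [ g , h ]    ≈⟨ Eᶜ≈𝟙⇒a≈0 [g,h]≈𝟙 ⟩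
        0#                    ≈⟨ -0#≈0# ⟨
        - 0#                  ∎))
        where open import Relation.Binary.Reasoning.Setoid setoid

    γ₃-nontrivial : (∀ {x y} → ¬ (x ≈ 0#) → x * y ≈ 0# → y ≈ 0#) → ¬ (1# + 1# ≈ 0#)
      → ∀ c → ¬ (c * S 1# - S c ≈ 0#) → ∃[ z ] (LCS F Graph 3 z × ¬ (z ≈ₘ 𝟙))
    γ₃-nontrivial cancel 2≉0 c nonlinear =
      Eᶜ [ [ g , h ] , h ] ,
      gen (Eᶜ [ g , h ] , Eᶜ h ,
           gen (Eᶜ g , Eᶜ h , Eᶜ∈Graph 0# 0# c , Eᶜ∈Graph 0# 0# 1# , Eᶜ-IsComm g h) ,
           Eᶜ∈Graph 0# 0# 1# , Eᶜ-IsComm [ g , h ] h) ,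
      nontrivial
      where
      g h : Coords Carrier
      g = ⟨ 0# , 0# , c , S c ⟩
      h = ⟨ 0# , 0# , 1# , S 1# ⟩
      nontrivial : ¬ (Eᶜ [ [ g , h ] , h ] ≈ₘ 𝟙)
      nontrivial z≈𝟙 = nonlinear (cancel 2≉0 (-‿injective
        (trans (sym (proj₁ (γ₃-witness-closedForm c (S c) (S 1#)))) (trans (Eᶜ≈𝟙⇒a≈0 z≈𝟙) (sym -0#≈0#)))))

fixedPointFreeInvolution⇒even : ∀ n (σ : Fin n → Fin n) →
  (∀ i → σ (σ i) ≡ i) → (∀ i → σ i ≢ i) → 2 ∣ n
fixedPointFreeInvolution⇒even zero σ _ _ = 2 ∣0
fixedPointFreeInvolution⇒even (suc zero) σ _ σi≢i with σ f0 in σ0≡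
... | f0 = ⊥-elim (σi≢i f0 σ0≡)
fixedPointFreeInvolution⇒even (suc (suc n)) σ σσi≡i σi≢i with σ f0 in σ0≡
... | f0   = ⊥-elim (σi≢i f0 σ0≡)
... | fs j = ∣m∣n⇒∣m+n ∣-refl (fixedPointFreeInvolution⇒even n τ ττi≡i τi≢i)
  where
  -- ι enumerates the complement of the orbit {0 , σ 0} of σ.
  ι : Fin n → Fin (suc (suc n))
  ι i = fs (Fin.punchIn j i)

  ι-injective : ∀ {i i'} → ι i ≡ ι i' → i ≡ i'
  ι-injective ιi≡ιi' = Fin.punchIn-injective j _ _ (Fin.suc-injective ιi≡ιi')

  0≢σι : ∀ i → f0 ≢ σ (ι i)
  0≢σι i 0≡σιi = Fin.punchInᵢ≢i j i (Fin.suc-injective (begin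
    ι i           ≡⟨ σσi≡i (ι i) ⟨
    σ (σ (ι i))   ≡⟨ ≡.cong σ 0≡σιi ⟨
    σ f0          ≡⟨ σ0≡ ⟩
    fs j          ∎))
    where open ≡.≡-Reasoning

  j≢σι : ∀ i → j ≢ Fin.punchOut (0≢σι i)
  j≢σι i j≡ = Fin.0≢1+n (≡.sym (begin
    ι i                               ≡⟨ σσi≡i (ι i) ⟨
    σ (σ (ι i))                       ≡⟨ ≡.cong σ (Fin.punchIn-punchOut (0≢σι i)) ⟨
    σ (fs (Fin.punchOut (0≢σι i)))    ≡⟨ ≡.cong (λ k → σ (fs k)) j≡ ⟨
    σ (fs j)                          ≡⟨ ≡.cong σ σ0≡ ⟨
    σ (σ f0)                          ≡⟨ σσi≡i f0 ⟩
    f0                                ∎))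
    where open ≡.≡-Reasoning

  τ : Fin n → Fin n
  τ i = Fin.punchOut (j≢σι i)

  ιτ≡σι : ∀ i → ι (τ i) ≡ σ (ι i)
  ιτ≡σι i = ≡.trans (≡.cong fs (Fin.punchIn-punchOut (j≢σι i))) (Fin.punchIn-punchOut (0≢σι i))

  ττi≡i : ∀ i → τ (τ i) ≡ i
  ττi≡i i = ι-injective (≡.trans (ιτ≡σι (τ i)) (≡.trans (≡.cong σ (ιτ≡σι i)) (σσi≡i (ι i))))

  τi≢i : ∀ i → τ i ≢ i
  τi≢i i τi≡i = σi≢i (ι i) (≡.trans (≡.sym (ιτ≡σι i)) (≡.cong ι τi≡i))

module FiniteField {c ℓ} (F : CommutativeRing c ℓ) (isField : IsField F) {q} (size : HasSize F q) where
  open CommutativeRing F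
  open IsField isField
  open HasSize size
  open import Relation.Binary.Reasoning.Setoid setoid

  infix 4 _≟_
  _≟_ : ∀ x y → Dec (x ≈ y)
  x ≟ y with enum-surj x | enum-surj y
  ... | i , eᵢ≈x | j , eⱼ≈y = Dec.map′ (λ { ≡.refl → trans (sym eᵢ≈x) eⱼ≈y })
                                       (λ x≈y → enum-inj i j (trans eᵢ≈x (trans x≈y (sym eⱼ≈y))))
                                       (i Fin.≟ j)

  cancel : ∀ {x y} → ¬ (x ≈ 0#) → x * y ≈ 0# → y ≈ 0#
  cancel {x} {y} x≉0 xy≈0 with inverse x x≉0
  ... | x⁻¹ , xx⁻¹≈1 = begin
    y               ≈⟨ *-identityˡ y ⟨
    1# * y          ≈⟨ *-congʳ (trans (sym xx⁻¹≈1) (*-comm x x⁻¹)) ⟩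
    (x⁻¹ * x) * y   ≈⟨ *-assoc x⁻¹ x y ⟩
    x⁻¹ * (x * y)   ≈⟨ *-congˡ xy≈0 ⟩
    x⁻¹ * 0#        ≈⟨ zeroʳ x⁻¹ ⟩
    0#              ∎

  -- If 1 + 1 = 0 then translation by 1 pairs up the elements of F.
  odd⇒1+1≉0 : ¬ (2 ∣ q) → ¬ (1# + 1# ≈ 0#)
  odd⇒1+1≉0 q-odd 1+1≈0 = q-odd (fixedPointFreeInvolution⇒even q σ σσi≡i σi≢i)
    where
    σ : Fin q → Fin q
    σ i = proj₁ (enum-surj (enum i + 1#))

    eσ≈e+1 : ∀ i → enum (σ i) ≈ enum i + 1#
    eσ≈e+1 i = proj₂ (enum-surj (enum i + 1#))

    σσi≡i : ∀ i → σ (σ i) ≡ i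
    σσi≡i i = enum-inj _ _ (begin
      enum (σ (σ i))        ≈⟨ eσ≈e+1 (σ i) ⟩
      enum (σ i) + 1#       ≈⟨ +-congʳ (eσ≈e+1 i) ⟩
      enum i + 1# + 1#      ≈⟨ +-assoc (enum i) 1# 1# ⟩
      enum i + (1# + 1#)    ≈⟨ +-congˡ 1+1≈0 ⟩
      enum i + 0#           ≈⟨ +-identityʳ (enum i) ⟩
      enum i                ∎)

    σi≢i : ∀ i → σ i ≢ i
    σi≢i i σi≡i = 0≉1 (sym (begin
      1#                    ≈⟨ +-identityˡ 1# ⟨
      0# + 1#               ≈⟨ +-congʳ (-‿inverseˡ (enum i)) ⟨
      - enum i + enum i + 1# ≈⟨ +-assoc (- enum i) (enum i) 1# ⟩
      - enum i + (enum i + 1#) ≈⟨ +-congˡ (eσ≈e+1 i) ⟨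
      - enum i + enum (σ i)  ≡⟨ ≡.cong (λ k → - enum i + enum k) σi≡i ⟩
      - enum i + enum i      ≈⟨ -‿inverseˡ (enum i) ⟩
      0#                    ∎))

module PolynomialRoots {c ℓ} (R : CommutativeRing c ℓ) where
  open CommutativeRing R
  open FiniteSums R
  open IntegerCoefficients R using (solve; _:=_; _:+_; _:*_; _:-_; con)
  open import Algebra.Properties.Ring ring using (x∙y⁻¹≈ε⇒x≈y)
  open import Relation.Binary.Reasoning.Setoid setoid

  horner : ∀ {n} → Vec Carrier n → Carrier → Carrier
  horner []      x = 0#
  horner (a ∷ v) x = a + x * horner v x

  horner-tabulate : ∀ n (f : Fin n → Carrier) x →
    horner (tabulate f) x ≈ ∑ n (λ k → f k * pow R x (toℕ k))
  horner-tabulate zero    f x = refl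
  horner-tabulate (suc n) f x = +-cong (sym (*-identityʳ (f f0))) (begin
    x * horner (tabulate (λ k → f (fs k))) x            ≈⟨ *-congˡ (horner-tabulate n (λ k → f (fs k)) x) ⟩
    x * ∑ n (λ k → f (fs k) * pow R x (toℕ k))          ≈⟨ ∑-*ˡ n x _ ⟩
    ∑ n (λ k → x * (f (fs k) * pow R x (toℕ k)))        ≈⟨ ∑-cong n (λ k → x∙yz≈y∙xz x _ _) ⟩
    ∑ n (λ k → f (fs k) * (x * pow R x (toℕ k)))        ∎)
    where open import Algebra.Properties.CommutativeSemigroup *-commutativeSemigroup using (x∙yz≈y∙xz)

  divide : ∀ {n} → Carrier → Vec Carrier (suc n) → Vec Carrier n × Carrier
  divide r (a ∷ [])        = [] , a
  divide r (a ∷ v@(_ ∷ _)) = let (q , ρ) = divide r v in ρ ∷ q , a + r * ρ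

  horner-divide : ∀ {n} r (v : Vec Carrier (suc n)) x →
    horner v x ≈ proj₂ (divide r v) + (x - r) * horner (proj₁ (divide r v)) x
  horner-divide r (a ∷ []) x = +-congˡ (trans (zeroʳ x) (sym (zeroʳ (x - r))))
  horner-divide r (a ∷ v@(_ ∷ _)) x = begin
    a + x * horner v x                 ≈⟨ +-congˡ (*-congˡ (horner-divide r v x)) ⟩
    a + x * (ρ + (x - r) * H)          ≈⟨ regroup a x r ρ H ⟩
    a + r * ρ + (x - r) * (ρ + x * H)  ∎
    where
    regroup : ∀ a x r ρ H → a + x * (ρ + (x - r) * H) ≈ a + r * ρ + (x - r) * (ρ + x * H)
    regroup = solve 5 (λ a x r ρ H → a :+ x :* (ρ :+ (x :- r) :* H) := a :+ r :* ρ :+ (x :- r) :* (ρ :+ x :* H)) refl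
    ρ H : Carrier
    ρ = proj₂ (divide r v)
    H = horner (proj₁ (divide r v)) x

  divide≈0⇒≈0 : ∀ {n} r (v : Vec Carrier (suc n)) →
    (∀ k → lookup (proj₁ (divide r v)) k ≈ 0#) → proj₂ (divide r v) ≈ 0# → ∀ k → lookup v k ≈ 0#
  divide≈0⇒≈0 r (a ∷ []) _ a≈0 f0 = a≈0
  divide≈0⇒≈0 r (a ∷ v@(_ ∷ _)) q≈0 a+rρ≈0 f0 =
    trans (sym (trans (+-congˡ (trans (*-congˡ (q≈0 f0)) (zeroʳ r))) (+-identityʳ a))) a+rρ≈0
  divide≈0⇒≈0 r (a ∷ v@(_ ∷ _)) q≈0 a+rρ≈0 (fs k) =
    divide≈0⇒≈0 r v (λ k → q≈0 (fs k)) (q≈0 f0) k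

  vanishing⇒zero : (∀ {x y} → ¬ (x ≈ 0#) → x * y ≈ 0# → y ≈ 0#) →
    ∀ n (v : Vec Carrier n) (pts : Fin n → Carrier) → (∀ i j → pts i ≈ pts j → i ≡ j) →
    (∀ i → horner v (pts i) ≈ 0#) → ∀ k → lookup v k ≈ 0#
  vanishing⇒zero cancel (suc n) v pts distinct roots =
    divide≈0⇒≈0 r v q≈0 ρ≈0
    where
    r ρ : Carrier
    r = pts f0
    ρ = proj₂ (divide r v)
    q : Vec Carrier n
    q = proj₁ (divide r v)
    v≈ρ+[x-r]q : ∀ x → horner v x ≈ ρ + (x - r) * horner q x
    v≈ρ+[x-r]q = horner-divide r v
    ρ≈0 : ρ ≈ 0#
    ρ≈0 = begin
      ρ                        ≈⟨ +-identityʳ ρ ⟨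
      ρ + 0#                   ≈⟨ +-congˡ (trans (*-congʳ (-‿inverseʳ r)) (zeroˡ _)) ⟨
      ρ + (r - r) * horner q r ≈⟨ v≈ρ+[x-r]q r ⟨
      horner v r               ≈⟨ roots f0 ⟩
      0#                       ∎
    q-roots : ∀ i → horner q (pts (fs i)) ≈ 0#
    q-roots i = cancel (λ x-r≈0 → Fin.0≢1+n (distinct f0 (fs i) (sym (x∙y⁻¹≈ε⇒x≈y _ _ x-r≈0)))) (begin
      (pts (fs i) - r) * horner q (pts (fs i))       ≈⟨ +-identityˡ _ ⟨
      0# + (pts (fs i) - r) * horner q (pts (fs i))  ≈⟨ +-congʳ ρ≈0 ⟨
      ρ + (pts (fs i) - r) * horner q (pts (fs i))   ≈⟨ v≈ρ+[x-r]q (pts (fs i)) ⟨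
      horner v (pts (fs i))                          ≈⟨ roots (fs i) ⟩
      0#                                             ∎)
    q≈0 : ∀ k → lookup q k ≈ 0#
    q≈0 = vanishing⇒zero cancel n q (pts ∘ fs) (λ i j e → Fin.suc-injective (distinct (fs i) (fs j) e)) q-roots

module LinearizedPolynomial {c ℓ} (F : CommutativeRing c ℓ) (p : ℕ) (1<p : 1 ℕ.< p) where
  open CommutativeRing F
  open FiniteSums F
  open IntegerCoefficients F using (solve; _:=_; _:*_; _:-_; con)
  open import Relation.Binary.Reasoning.Setoid setoid

  instance
    p≢0 : ℕ.NonZero p
    p≢0 = ℕ.>-nonZero (ℕ.<-trans ℕ.z<s 1<p)

  p^-injective : ∀ {i j} → p ℕ.^ i ≡ p ℕ.^ j → i ≡ j
  p^-injective {i} {j} p^i≡p^j with ℕ.<-cmp i j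
  ... | tri< i<j _ _ = ⊥-elim (ℕ.<-irrefl p^i≡p^j (ℕ.^-monoʳ-< p 1<p i<j))
  ... | tri≈ _ i≡j _ = i≡j
  ... | tri> _ _ j<i = ⊥-elim (ℕ.<-irrefl (≡.sym p^i≡p^j) (ℕ.^-monoʳ-< p 1<p j<i))

  S-zero : ∀ m s → linEval F p m s 0# ≈ 0#
  S-zero m s = trans (∑-cong m (λ i → trans (*-congˡ (0^p^i≈0 (toℕ i))) (zeroʳ (s i)))) (∑-zero m)
    where
    0^p^i≈0 : ∀ i → pow F 0# (p ℕ.^ i) ≈ 0#
    0^p^i≈0 i with p ℕ.^ i | ℕ.m^n>0 p i
    ... | suc _ | _ = zeroˡ _

  S-linear : ∀ m s → (∀ i → 1 ℕ.< p ℕ.^ toℕ i → s i ≈ 0#) → ∃[ κ ] (∀ x → linEval F p m s x ≈ κ * x)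
  S-linear zero    s _    = 0# , λ x → sym (zeroˡ x)
  S-linear (suc m) s s≈0 = s f0 , λ x → begin
    s f0 * (x * 1#) + ∑ m (λ i → s (fs i) * pow F x (p ℕ.^ suc (toℕ i)))
      ≈⟨ +-cong (*-congˡ (*-identityʳ x)) (∑-cong m (higher-term≈0 x)) ⟩
    s f0 * x + ∑ m (λ _ → 0#)
      ≈⟨ +-congˡ (∑-zero m) ⟩
    s f0 * x + 0#
      ≈⟨ +-identityʳ _ ⟩
    s f0 * x ∎
    where
    1<p^1+ : ∀ i → 1 ℕ.< p ℕ.^ suc i
    1<p^1+ i = ℕ.<-≤-trans 1<p (ℕ.m≤m*n p (p ℕ.^ i) {{ℕ.>-nonZero (ℕ.m^n>0 p i)}})
    higher-term≈0 : ∀ x i → s (fs i) * pow F x (p ℕ.^ suc (toℕ i)) ≈ 0#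
    higher-term≈0 x i = trans (*-congʳ (s≈0 (fs i) (1<p^1+ (toℕ i)))) (zeroˡ _)

  δ : ℕ → ℕ → Carrier
  δ i j with i ℕ.≟ j
  ... | yes _ = 1#
  ... | no  _ = 0#

  δ-refl : ∀ i → δ i i ≈ 1#
  δ-refl i with i ℕ.≟ i
  ... | yes _  = refl
  ... | no i≢i = ⊥-elim (i≢i ≡.refl)

  δ-≢ : ∀ {i j} → i ≢ j → δ i j ≈ 0#
  δ-≢ {i} {j} i≢j with i ℕ.≟ j
  ... | yes i≡j = ⊥-elim (i≢j i≡j)
  ... | no  _   = refl

  ∑-δ : ∀ N K → K ℕ.< N → (h : ℕ → Carrier) → ∑ N (λ k → δ (toℕ k) K * h (toℕ k)) ≈ h K
  ∑-δ N K K<N h = trans (∑-single N _ (Fin.fromℕ< K<N) off-diagonal) diagonal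
    where
    off-diagonal : ∀ k → k ≢ Fin.fromℕ< K<N → δ (toℕ k) K * h (toℕ k) ≈ 0#
    off-diagonal k k≢K = trans (*-congʳ (δ-≢ toℕk≢K)) (zeroˡ _)
      where
      toℕk≢K : toℕ k ≢ K
      toℕk≢K k≡K = k≢K (Fin.toℕ-injective (≡.trans k≡K (≡.sym (Fin.toℕ-fromℕ< K<N))))
    diagonal : δ (toℕ (Fin.fromℕ< K<N)) K * h (toℕ (Fin.fromℕ< K<N)) ≈ h K
    diagonal rewrite Fin.toℕ-fromℕ< K<N = trans (*-congʳ (δ-refl K)) (*-identityˡ (h K))

  module Defect (m : ℕ) (s : Fin m → Carrier) where
    S : Carrier → Carrier
    S = linEval F p m s

    p^_ : Fin m → ℕ
    p^ i = p ℕ.^ toℕ i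

    -- coefficients of the polynomial X S(1) - S(X)
    coefficient : ℕ → Carrier
    coefficient k = ∑ m (λ i → s i * (δ k 1 - δ k (p^ i)))

    1^n≈1 : ∀ n → pow F 1# n ≈ 1#
    1^n≈1 zero    = refl
    1^n≈1 (suc n) = trans (*-identityˡ _) (1^n≈1 n)

    coefficient-eval : ∀ N x → 1 ℕ.< N → (∀ i → p^ i ℕ.< N) →
      ∑ N (λ k → coefficient (toℕ k) * pow F x (toℕ k)) ≈ x * S 1# - S x
    coefficient-eval N x 1<N p^i<N = begin
      ∑ N (λ k → coefficient (toℕ k) * X k)
        ≈⟨ ∑-cong N (λ k → ∑-*ʳ m (X k) _) ⟩
      ∑ N (λ k → ∑ m (λ i → s i * (δ (toℕ k) 1 - δ (toℕ k) (p^ i)) * X k))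
        ≈⟨ ∑-comm N m _ ⟩
      ∑ m (λ i → ∑ N (λ k → s i * (δ (toℕ k) 1 - δ (toℕ k) (p^ i)) * X k))
        ≈⟨ ∑-cong m (λ i → ∑-cong N (λ k → distribute (s i) _ _ (X k))) ⟩
      ∑ m (λ i → ∑ N (λ k → s i * (δ (toℕ k) 1 * X k - δ (toℕ k) (p^ i) * X k)))
        ≈⟨ ∑-cong m (λ i → ∑-*ˡ N (s i) _) ⟨
      ∑ m (λ i → s i * ∑ N (λ k → δ (toℕ k) 1 * X k - δ (toℕ k) (p^ i) * X k))
        ≈⟨ ∑-cong m (λ i → *-congˡ (∑-δ-δ i)) ⟩
      ∑ m (λ i → s i * (x * 1# - pow F x (p^ i)))
        ≈⟨ ∑-cong m (λ i → regroup (s i) x (pow F x (p^ i))) ⟩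
      ∑ m (λ i → x * (s i * 1#) - s i * pow F x (p^ i))
        ≈⟨ ∑-cong m (λ i → +-congʳ (*-congˡ (*-congˡ (1^n≈1 (p^ i))))) ⟨
      ∑ m (λ i → x * (s i * pow F 1# (p^ i)) - s i * pow F x (p^ i))
        ≈⟨ ∑-- m _ _ ⟩
      ∑ m (λ i → x * (s i * pow F 1# (p^ i))) - S x
        ≈⟨ +-congʳ (∑-*ˡ m x _) ⟨
      x * S 1# - S x ∎
      where
      X : Fin N → Carrier
      X k = pow F x (toℕ k)
      distribute : ∀ s d e y → s * (d - e) * y ≈ s * (d * y - e * y)
      distribute = solve 4 (λ s d e y → s :* (d :- e) :* y := s :* (d :* y :- e :* y)) refl
      regroup : ∀ s x y → s * (x * 1# - y) ≈ x * (s * 1#) - s * y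
      regroup = solve 3 (λ s x y → s :* (x :* con (+ 1) :- y) := x :* (s :* con (+ 1)) :- s :* y) refl
      ∑-δ-δ : ∀ i → ∑ N (λ k → δ (toℕ k) 1 * X k - δ (toℕ k) (p^ i) * X k) ≈ x * 1# - pow F x (p^ i)
      ∑-δ-δ i = trans (∑-- N _ _) (+-cong (∑-δ N 1 1<N (pow F x)) (-‿cong (∑-δ N (p^ i) (p^i<N i) (pow F x))))

    coefficient-p^ : ∀ i₀ → 1 ℕ.< p^ i₀ → coefficient (p^ i₀) ≈ - s i₀
    coefficient-p^ i₀ 1<p^i₀ = begin
      ∑ m (λ i → s i * (δ (p^ i₀) 1 - δ (p^ i₀) (p^ i)))
        ≈⟨ ∑-cong m (λ i → *-congˡ (trans (+-congʳ δ-p^i₀-1≈0) (+-identityˡ _))) ⟩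
      ∑ m (λ i → s i * - δ (p^ i₀) (p^ i))
        ≈⟨ ∑-cong m (λ i → sym (-‿distribʳ-* _ _)) ⟩
      ∑ m (λ i → - (s i * δ (p^ i₀) (p^ i)))
        ≈⟨ ∑-neg m _ ⟩
      - ∑ m (λ i → s i * δ (p^ i₀) (p^ i))
        ≈⟨ -‿cong (∑-single m _ i₀ off-diagonal) ⟩
      - (s i₀ * δ (p^ i₀) (p^ i₀))
        ≈⟨ -‿cong (trans (*-congˡ (δ-refl (p^ i₀))) (*-identityʳ _)) ⟩
      - s i₀ ∎
      where
      open import Algebra.Properties.Ring ring using (-‿distribʳ-*)
      δ-p^i₀-1≈0 : δ (p^ i₀) 1 ≈ 0#
      δ-p^i₀-1≈0 = δ-≢ (λ p^i₀≡1 → ℕ.<-irrefl (≡.sym p^i₀≡1) 1<p^i₀)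
      off-diagonal : ∀ i → i ≢ i₀ → s i * δ (p^ i₀) (p^ i) ≈ 0#
      off-diagonal i i≢i₀ = trans (*-congˡ (δ-≢ (i≢i₀ ∘ Fin.toℕ-injective ∘ p^-injective ∘ ≡.sym))) (zeroʳ _)

module ConstructionA {c ℓ} (p m : ℕ) (p-prime : Prime p) (F : CommutativeRing c ℓ)
  (isField : IsField F) (size : HasSize F (p ℕ.^ m)) (q-odd : ¬ (2 ∣ p ℕ.^ m))
  (s : Fin m → CommutativeRing.Carrier F) where
  open CommutativeRing F
  open HasSize size
  open FiniteField F isField size
  open PolynomialRoots F
  1<p : 1 ℕ.< p
  1<p = ℕ.nonTrivial⇒n>1 p {{prime⇒nonTrivial p-prime}}

  open LinearizedPolynomial F p 1<p
  open Defect m s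
  open EMatrices F
  open Graph S
  open import Algebra.Properties.Ring ring using (-‿injective; -0#≈0#)

  deg>1? : Dec (DegGT1 F p m s)
  deg>1? = Fin.any? (λ i → (1 ℕ.<? p ℕ.^ toℕ i) ×-dec Dec.¬? (s i ≟ 0#))

  deg≤1⇒linear : ¬ DegGT1 F p m s → ∃[ κ ] (∀ x → S x ≈ κ * x)
  deg≤1⇒linear deg≤1 = S-linear m s λ i 1<p^i →
    Dec.decidable-stable (s i ≟ 0#) (λ sᵢ≉0 → deg≤1 (i , 1<p^i , sᵢ≉0))

  deg>1⇒nonlinear : DegGT1 F p m s → ∃[ x ] ¬ (x * S 1# - S x ≈ 0#)
  deg>1⇒nonlinear (i₀ , 1<p^i₀ , sᵢ₀≉0) with Fin.any? (λ i → Dec.¬? (enum i * S 1# - S (enum i) ≟ 0#))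
  ... | yes (i , defect≉0) = enum i , defect≉0
  ... | no ¬∃ = ⊥-elim (sᵢ₀≉0 (-‿injective (begin
    - s i₀                              ≈⟨ coefficient-p^ i₀ 1<p^i₀ ⟨
    coefficient (p^ i₀)                 ≡⟨ ≡.cong coefficient (Fin.toℕ-fromℕ< (p^i<q i₀)) ⟨
    coefficient (toℕ k₀)                ≡⟨ lookup∘tabulate (λ k → coefficient (toℕ k)) k₀ ⟨
    lookup coefficients k₀              ≈⟨ vanishing⇒zero cancel q coefficients enum enum-inj roots k₀ ⟩
    0#                                  ≈⟨ -0#≈0# ⟨
    - 0#                                ∎)))
    where
    open import Relation.Binary.Reasoning.Setoid setoid
    q : ℕ
    q = p ℕ.^ m
    p^i<q : ∀ i → p^ i ℕ.< q
    p^i<q i = ℕ.^-monoʳ-< p 1<p (Fin.toℕ<n i)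
    k₀ : Fin q
    k₀ = Fin.fromℕ< (p^i<q i₀)
    coefficients : Vec Carrier q
    coefficients = tabulate (λ k → coefficient (toℕ k))
    roots : ∀ i → horner coefficients (enum i) ≈ 0#
    roots i = begin
      horner coefficients (enum i)
        ≈⟨ horner-tabulate q _ (enum i) ⟩
      ∑ q (λ k → coefficient (toℕ k) * pow F (enum i) (toℕ k))
        ≈⟨ coefficient-eval q (enum i) (ℕ.<-trans 1<p^i₀ (p^i<q i₀)) p^i<q ⟩
      enum i * S 1# - S (enum i)
        ≈⟨ Dec.decidable-stable (_ ≟ 0#) (λ defect≉0 → ¬∃ (i , defect≉0)) ⟩
      0# ∎
      where open FiniteSums F using (∑)

  hasClass₂ : ¬ DegGT1 F p m s → HasClass F Graph 2
  hasClass₂ deg≤1 =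
    let (κ , S≈κ*) = deg≤1⇒linear deg≤1
    in  Linear.γ₃≈𝟙 κ S≈κ* , γ₂-nontrivial (S-zero m s) (odd⇒1+1≉0 q-odd)

  hasClass₃ : DegGT1 F p m s → HasClass F Graph 3
  hasClass₃ deg>1 =
    let (x , nonlinear) = deg>1⇒nonlinear deg>1
    in  γ₄≈𝟙 , γ₃-nontrivial cancel (odd⇒1+1≉0 q-odd) x nonlinear

HasClass⇒¬HasClass-suc : ∀ {c ℓ} (F : CommutativeRing c ℓ) H n → HasClass F H n → ¬ HasClass F H (suc n)
HasClass⇒¬HasClass-suc F H n (γ₁₊ₙ≈𝟙 , _) (_ , z , z∈γ₁₊ₙ , z≉𝟙) = z≉𝟙 (γ₁₊ₙ≈𝟙 z z∈γ₁₊ₙ)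

theorem8p7 : ∀ {c ℓ : Level} (p m : ℕ) → Prime p → (F : CommutativeRing c ℓ) → IsField F
    → HasSize F (p ^ m) → ¬ (2 ∣ p ^ m) → (s : Fin m → CommutativeRing.Carrier F)
    → (HasClass F (GroupA F p m s) 2 ⊎ HasClass F (GroupA F p m s) 3)
      × (HasClass F (GroupA F p m s) 3 ⇔ DegGT1 F p m s)
theorem8p7 {c} {ℓ} p m p-prime F isField size q-odd s = classify deg>1?
  where
  open ConstructionA p m p-prime F isField size q-odd s
  G : Mat F → Set (c ⊔ ℓ)
  G = GroupA F p m s
  classify : Dec (DegGT1 F p m s) → (HasClass F G 2 ⊎ HasClass F G 3) × (HasClass F G 3 ⇔ DegGT1 F p m s)
  classify (yes deg>1) = inj₂ (hasClass₃ deg>1) , mk⇔ (λ _ → deg>1) (λ _ → hasClass₃ deg>1)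
  classify (no deg≤1)  = inj₁ (hasClass₂ deg≤1) ,
    mk⇔ (⊥-elim ∘ HasClass⇒¬HasClass-suc F G 2 (hasClass₂ deg≤1)) (⊥-elim ∘ deg≤1)
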